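{- Let $\mathcal{D}=\{(\Sigma_k,L_k,G_k)\}_{k}$ be a treelike decomposition class of arity $r$ with automation $\mathcal{A}$, let $C$ be a $\mathcal{D}$-coherent treelike DP-core, and let $(q_1,S_1)(q_2,S_2)\dots(q_m,S_m)$ be an $(\mathcal{A},C,k)$-refutation. Then there is a $\mathcal{D}$-decomposition $\tau\in L_k$ such that $G(\tau)\in P(\mathcal{D}_k)\setminus P(C,\mathcal{D})$, $\tau$ has height at most $m-1$, and $|\tau|\le m$ if $r=1$, and $|\tau|\le\frac{r^m-1}{r-1}$ if $r>1$.
   Context: Graphs: triples $G=(V,E,I)$, $V,E$ finite subsets of $\mathbb{N}$, $I\subseteq E\times V$; $\simeq$ isomorphism; isomorphism closure of a set of graphs = all graphs isomorphic to one of its members. Terms over a ranked alphabet: finite rooted ordered labelled trees (arity = number of children); $|\tau|$ = number of nodes; height = height of the tree. Tree automata have states, final states and transitions $a(q_1,\dots,q_p)\to q$. Treelike decomposition class of arity $r$: $\mathcal{D}=\{(\Sigma_k,L_k,G_k)\}_{k}$, $\Sigma_k$ ranked alphabet of arity $\le r$, $L_k$ regular tree language over $\Sigma_k$, $G_k:L_k\to$ graphs, $\Sigma_k\subseteq\Sigma_{k+1}$, $L_k\subseteq L_{k+1}$, $G_{k+1}|_{L_k}=G_k$; $G(\tau)=G_k(\tau)$; $P(\mathcal{D}_k)$ = isomorphism closure of $\{G(\tau):\tau\in L_k\}$. An automation is a sequence of tree automata $A_k$ accepting exactly $L_k$. Treelike DP-core $C=\{C[k]\}$, $C[k]=(\Sigma_k,W_k,F_k,T_k,\mathrm{Clean}_k,\mathrm{Inv}_k)$: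 $W_k\subseteq\{0,1\}^*$ decidable; $F_k:W_k\to\{0,1\}$ (final witnesses); finite $\hat a\subseteq W_k$ for arity-$0$ $a$; $\hat a:W_k^p\to$ finite subsets of $W_k$ for arity $p\ge1$; $\mathrm{Clean}_k$, $\mathrm{Inv}_k$ map finite subsets of $W_k$ to finite subsets of $W_k$, resp. to $\{0,1\}^*$. $\hat a(S_1,\dots,S_p)=\mathrm{Clean}_k(\bigcup_{w_i\in S_i}\hat a(w_1,\dots,w_p))$; $\mathrm{Dyn}_k(a)=\hat a$ (arity $0$), $\mathrm{Dyn}_k(a(\tau_1,\dots,\tau_p))=\hat a(\mathrm{Dyn}_k(\tau_1),\dots,\mathrm{Dyn}_k(\tau_p))$; $\tau$ accepted by $C[k]$ iff $\mathrm{Dyn}_k(\tau)$ has a final witness. $P(C,\mathcal{D})$ = isomorphism closure of $\{G(\tau):\tau\in L_k$ accepted by $C[k]$, some $k\}$. $\mathcal{D}$-coherent: alphabets of $C$ are the $\Sigma_k$; for $\tau\in L_k,\tau'\in L_{k'}$ with $G(\tau)\simeq G(\tau')$, acceptance by $C[k]$ and $C[k']$ agree, and $\mathrm{Inv}_k(\mathrm{Dyn}_k(\tau))=\mathrm{Inv}_{k'}(\mathrm{Dyn}_{k'}(\tau'))$. Refutation: an $(\mathcal{A},C,k)$-pair is $(q,S)$, $q$ a state of $A_k$, $S\subseteq W_k$; inconsistent if $q$ is final but $S$ contains no final witness. An $(\mathcal{A},C,k)$-refutation is a sequence $(q_1,S_1)\dots(q_m,S_m)$ of pairs with $(q_m,S_m)$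 inconsistent and each $(q_i,S_i)$ either equal to $(q,\hat a)$ with $a$ of arity $0$ and $a\to q$ a transition of $A_k$, or to $(q,\hat a(S_{j_1},\dots,S_{j_p}))$ with $j_1,\dots,j_p<i$, $a$ of arity $p>0$, and $a(q_{j_1},\dots,q_{j_p})\to q$ a transition of $A_k$. -}

module Defs where

open import Data.Nat using (ℕ; zero; suc; s≤s; _+_; _∸_; _^_; _≤_; _<_; _⊔_)
open import Data.Nat.DivMod using (_/_)
open import Data.Bool using (Bool; T)
open import Data.List using (List; []; _∷_; concatMap; foldr; map)
open import Data.List.Membership.Propositional using (_∈_)
open import Data.List.Relation.Unary.All using (All)
open import Data.List.Relation.Unary.Any using (Any)
open import Data.Vec using (Vec; []; _∷_; toList)
import Data.Vec as Vec
open import Data.Fin using (Fin; toℕ)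
open import Data.Product using (Σ; ∃; _×_; _,_; Σ-syntax; ∃-syntax; proj₁)
open import Function.Bundles using (_⇔_)
open import Relation.Binary.PropositionalEquality using (_≡_)

-- Graphs G = (V , E , I), V, E finite subsets of ℕ (given as lists,
-- read as sets), I ⊆ E × V.

record Graph : Set where
  field
    V   : List ℕ
    E   : List ℕ
    I   : List (ℕ × ℕ)
    I⊆  : All (λ p → (Data.Product.proj₁ p ∈ E) × (Data.Product.proj₂ p ∈ V)) I

open Graph public

_≈ₛ_ : {A : Set} → List A → List A → Set
xs ≈ₛ ys = ∀ x → (x ∈ xs) ⇔ (x ∈ ys)

_≐_ : Graph → Graph → Set
G ≐ H = (V G ≈ₛ V H) × (E G ≈ₛ E H) × (I G ≈ₛ I H)

BijOn : (ℕ → ℕ) → List ℕ → List ℕ → Set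
BijOn f xs ys =
    (∀ x → x ∈ xs → f x ∈ ys)
  × (∀ x y → x ∈ xs → y ∈ xs → f x ≡ f y → x ≡ y)
  × (∀ y → y ∈ ys → ∃[ x ] (x ∈ xs × f x ≡ y))

_≃_ : Graph → Graph → Set
G ≃ H = Σ[ fV ∈ (ℕ → ℕ) ] Σ[ fE ∈ (ℕ → ℕ) ]
    BijOn fV (V G) (V H)
  × BijOn fE (E G) (E H)
  × (∀ e v → e ∈ E G → v ∈ V G → ((e , v) ∈ I G) ⇔ ((fE e , fV v) ∈ I H))

module Terms (Sym : Set) (arity : Sym → ℕ) where

  data Term : Set where
    node : (a : Sym) → Vec Term (arity a) → Term

  mutual
    size : Term → ℕ
    size (node a ts) = suc (sizes ts)

    sizes : ∀ {n} → Vec Term n → ℕ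
    sizes []       = 0
    sizes (t ∷ ts) = size t + sizes ts

  -- height: leaves have height 0
  mutual
    height : Term → ℕ
    height (node a ts) = heights ts

    heights : ∀ {n} → Vec Term n → ℕ
    heights []       = 0
    heights (t ∷ ts) = suc (height t) ⊔ heights ts

  mutual
    data Over (Σ' : List Sym) : Term → Set where
      node : ∀ {a ts} → a ∈ Σ' → OverV Σ' ts → Over Σ' (node a ts)

    data OverV (Σ' : List Sym) : ∀ {n} → Vec Term n → Set where
      []  : OverV Σ' []
      _∷_ : ∀ {n t} {ts : Vec Term n} → Over Σ' t → OverV Σ' ts → OverV Σ' (t ∷ ts)

  record TreeAutomaton (Σ' : List Sym) : Set where
    field
      nStates     : ℕ
      final       : Fin nStates → Bool
      -- transition a(q₁,…,q_p) → q  is the entry (a , (q₁ … q_p) , q)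
      transitions : List (Σ[ a ∈ Sym ] (Vec (Fin nStates) (arity a) × Fin nStates))
      trans-alph  : All (λ t → proj₁ t ∈ Σ') transitions

    Transition : (a : Sym) → Vec (Fin nStates) (arity a) → Fin nStates → Set
    Transition a qs q = (a , qs , q) ∈ transitions

    mutual
      data Run : Term → Fin nStates → Set where
        node : ∀ {a ts q} (qs : Vec (Fin nStates) (arity a)) →
               Transition a qs q → Runs ts qs → Run (node a ts) q

      data Runs : ∀ {n} → Vec Term n → Vec (Fin nStates) n → Set where
        []  : Runs [] []
        _∷_ : ∀ {n t q} {ts : Vec Term n} {qs} → Run t q → Runs ts qs → Runs (t ∷ ts) (q ∷ qs)

    Accepts : Term → Set
    Accepts τ = Over Σ' τ × ∃[ q ] (T (final q) × Run τ q)

  record DecompClass (r : ℕ) : Set₁ where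
    field
      Σₖ        : ℕ → List Sym
      Σ-arity   : ∀ k a → a ∈ Σₖ k → arity a ≤ r
      Σ-mono    : ∀ k a → a ∈ Σₖ k → a ∈ Σₖ (suc k)
      L         : ℕ → Term → Bool
      L-over    : ∀ k τ → T (L k τ) → Over (Σₖ k) τ
      L-regular : ∀ k → Σ[ A ∈ TreeAutomaton (Σₖ k) ]
                          (∀ τ → T (L k τ) ⇔ TreeAutomaton.Accepts A τ)
      L-mono    : ∀ k τ → T (L k τ) → T (L (suc k) τ)
      Gₖ        : (k : ℕ) (τ : Term) → T (L k τ) → Graph
      G-compat  : ∀ k τ (p : T (L k τ)) (p' : T (L (suc k) τ)) →
                  Gₖ (suc k) τ p' ≐ Gₖ k τ p

    InPDk : ℕ → Graph → Set
    InPDk k H = Σ[ τ ∈ Term ] Σ[ p ∈ T (L k τ) ] (H ≃ Gₖ k τ p)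

  record Automation {r : ℕ} (D : DecompClass r) : Set where
    open DecompClass D
    field
      A       : (k : ℕ) → TreeAutomaton (Σₖ k)
      correct : ∀ k τ → T (L k τ) ⇔ TreeAutomaton.Accepts (A k) τ

  -- treelike DP-cores (over the alphabets Σ_k of the decomposition class;
  -- \hat a is given for every symbol, only symbols of Σ_k matter)

  choices : {A : Set} {p : ℕ} → Vec (List A) p → List (Vec A p)
  choices []       = [] ∷ []
  choices (S ∷ Ss) = concatMap (λ w → map (w ∷_) (choices Ss)) S

  record DPCore : Set₁ where
    field
      W     : ℕ → List Bool → Bool
    Wit : ℕ → Set
    Wit k = Σ[ w ∈ List Bool ] T (W k w)
    field
      F     : (k : ℕ) → Wit k → Bool
      -- for arity 0 : \hat a = hat k a [] ; for arity p ≥ 1 : \hat a(w₁,…,w_p)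
      hat   : (k : ℕ) (a : Sym) → Vec (Wit k) (arity a) → List (Wit k)
      Clean : (k : ℕ) → List (Wit k) → List (Wit k)
      Inv   : (k : ℕ) → List (Wit k) → List Bool

    hatSetAux : (k p : ℕ) → (Vec (Wit k) p → List (Wit k)) → Vec (List (Wit k)) p → List (Wit k)
    hatSetAux k zero    f Ss = f []
    hatSetAux k (suc p) f Ss = Clean k (concatMap f (choices Ss))

    hatSet : (k : ℕ) (a : Sym) → Vec (List (Wit k)) (arity a) → List (Wit k)
    hatSet k a = hatSetAux k (arity a) (hat k a)

    mutual
      Dyn : (k : ℕ) → Term → List (Wit k)
      Dyn k (node a ts) = hatSet k a (Dyns k ts)

      Dyns : (k : ℕ) → ∀ {n} → Vec Term n → Vec (List (Wit k)) n
      Dyns k []       = []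
      Dyns k (t ∷ ts) = Dyn k t ∷ Dyns k ts

    HasFinal : (k : ℕ) → List (Wit k) → Set
    HasFinal k S = Any (λ w → T (F k w)) S

    AcceptedBy : ℕ → Term → Set
    AcceptedBy k τ = HasFinal k (Dyn k τ)

  module _ {r : ℕ} (D : DecompClass r) (C : DPCore) where
    open DecompClass D
    open DPCore C

    InPCD : Graph → Set
    InPCD H = Σ[ k ∈ ℕ ] Σ[ τ ∈ Term ] Σ[ p ∈ T (L k τ) ]
                (AcceptedBy k τ × (H ≃ Gₖ k τ p))

    Coherent : Set
    Coherent = ∀ k k' τ τ' (p : T (L k τ)) (p' : T (L k' τ')) →
               Gₖ k τ p ≃ Gₖ k' τ' p' →
               (AcceptedBy k τ ⇔ AcceptedBy k' τ')
             × (Inv k (Dyn k τ) ≡ Inv k' (Dyn k' τ'))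

  module _ {r : ℕ} {D : DecompClass r} (𝒜 : Automation D) (C : DPCore) (k : ℕ) where
    open DPCore C
    private
      Aₖ = Automation.A 𝒜 k
    open TreeAutomaton Aₖ

    Pair : Set
    Pair = Fin nStates × List (Wit k)

    Inconsistent : Pair → Set
    Inconsistent (q , S) = T (final q) × (HasFinal k S → Data.Empty.⊥)
      where import Data.Empty

    record Refutation (m : ℕ) : Set where
      field
        pairs     : Fin m → Pair
        -- each pair is (q , \hat a(S_{j₁},…,S_{j_p})) with j's earlier and
        -- a(q_{j₁},…,q_{j_p}) → q a transition of A_k (p = 0 : (q , \hat a), a → q)
        justified : ∀ i → Σ[ a ∈ Sym ] Σ[ js ∈ Vec (Fin m) (arity a) ]
                      All (λ j → toℕ j < toℕ i) (toList js)
                    × Transition a (Vec.map (λ j → Data.Product.proj₁ (pairs j)) js)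
                                   (Data.Product.proj₁ (pairs i))
                    × (Data.Product.proj₂ (pairs i)
                         ≡ hatSet k a (Vec.map (λ j → Data.Product.proj₂ (pairs j)) js))
        lastIdx   : Fin m
        isLast    : suc (toℕ lastIdx) ≡ m
        lastInc   : Inconsistent (pairs lastIdx)

geomBound : (r m : ℕ) → 1 < r → ℕ
geomBound (suc (suc r)) m _ = (suc (suc r) ^ m ∸ 1) / (suc (suc r) ∸ 1)
geomBound (suc zero) m (s≤s ())

{-# OPTIONS --safe #-}
-- A refutation is a recipe for a counterexample. By induction along the
-- sequence, every pair (qᵢ , Sᵢ) is realised by a term τᵢ over Σ_k on which
-- A_k has a run ending in qᵢ and with Dyn_k τᵢ = Sᵢ: the symbol and the
-- earlier pairs that justify (qᵢ , Sᵢ) give the root and the children of τᵢ.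
-- The term realising the last, inconsistent pair is in L_k but rejected by
-- C[k], and coherence transfers this rejection to every decomposition of an
-- isomorphic graph. Each node has at most r children, each realising an
-- earlier pair, so τᵢ has height ≤ i and at most 1 + r + ⋯ + rⁱ nodes.
module Submission where

open import Defs
open import Data.Nat using (ℕ; zero; suc; _+_; _*_; _^_; _∸_; _≤_; _<_; z≤n; s≤s)
open import Data.Nat.Properties
  using (≤-refl; ≤-reflexive; ≤-trans; ⊔-lub; +-mono-≤; *-monoˡ-≤; *-monoʳ-≤; *-identityˡ; m+n∸n≡m)
open import Data.Nat.DivMod using (_/_; m*n/n≡m)
open import Data.Nat.Tactic.RingSolver using (solve-∀)
open import Data.Bool using (T)
open import Data.Product using (_×_; _,_; Σ-syntax; proj₁; proj₂)
open import Data.List using (List)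
open import Data.List.Relation.Unary.All using (All; []; _∷_)
import Data.List.Relation.Unary.All as All
open import Data.Vec using (Vec; []; _∷_; toList)
import Data.Vec as Vec
open import Data.Fin using (Fin; toℕ)
open import Function.Bundles using (mk⇔; Equivalence)
open import Relation.Nullary using (¬_)
open import Relation.Binary.PropositionalEquality using (_≡_; refl; sym; trans; cong; cong₂; subst; module ≡-Reasoning)

geomSum : ℕ → ℕ → ℕ
geomSum r zero    = 0
geomSum r (suc n) = suc (r * geomSum r n)

geomSum-mono-≤ : ∀ r {m n} → m ≤ n → geomSum r m ≤ geomSum r n
geomSum-mono-≤ r z≤n       = z≤n
geomSum-mono-≤ r (s≤s m≤n) = s≤s (*-monoʳ-≤ r (geomSum-mono-≤ r m≤n))

geomSum-1 : ∀ n → geomSum 1 n ≡ n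
geomSum-1 zero    = refl
geomSum-1 (suc n) = cong suc (trans (*-identityˡ (geomSum 1 n)) (geomSum-1 n))

geomSum*pred+1≡^ : ∀ r n → geomSum (suc r) n * r + 1 ≡ suc r ^ n
geomSum*pred+1≡^ r zero    = refl
geomSum*pred+1≡^ r (suc n) = begin
  suc (suc r * g) * r + 1 ≡⟨ unfold r g ⟩
  suc r * (g * r + 1)     ≡⟨ cong (suc r *_) (geomSum*pred+1≡^ r n) ⟩
  suc r * suc r ^ n       ∎
  where
  open ≡-Reasoning
  g = geomSum (suc r) n
  unfold : ∀ s x → suc (suc s * x) * s + 1 ≡ suc s * (x * s + 1)
  unfold = solve-∀

geomSum≡geomBound : ∀ r n (1<r : 1 < r) → geomSum r n ≡ geomBound r n 1<r
geomSum≡geomBound (suc zero)    n (s≤s ())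
geomSum≡geomBound (suc (suc r)) n _ = sym (begin
  (suc (suc r) ^ n ∸ 1) / suc r ≡⟨ cong (λ x → (x ∸ 1) / suc r) (sym (geomSum*pred+1≡^ (suc r) n)) ⟩
  (g * suc r + 1 ∸ 1) / suc r   ≡⟨ cong (_/ suc r) (m+n∸n≡m (g * suc r) 1) ⟩
  g * suc r / suc r             ≡⟨ m*n/n≡m g (suc r) ⟩
  g                             ∎)
  where
  open ≡-Reasoning
  g = geomSum (suc (suc r)) n

≃-refl : ∀ G → G ≃ G
≃-refl G = (λ x → x) , (λ x → x) , idBijOn (V G) , idBijOn (E G) , λ _ _ _ _ → mk⇔ (λ x → x) (λ x → x)
  where
  idBijOn : ∀ xs → BijOn (λ x → x) xs xs
  idBijOn xs = (λ _ x∈xs → x∈xs) , (λ _ _ _ _ x≡y → x≡y) , (λ y y∈xs → y , y∈xs , refl)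

module _ (Sym : Set) (arity : Sym → ℕ) where
  open Terms Sym arity

  module _ {r : ℕ} (D : DecompClass r) where
    open DecompClass D

    Gₖ∈PDk : ∀ k τ (τ∈Lₖ : T (L k τ)) → InPDk k (Gₖ k τ τ∈Lₖ)
    Gₖ∈PDk k τ τ∈Lₖ = τ , τ∈Lₖ , ≃-refl (Gₖ k τ τ∈Lₖ)

    rejected⇒∉PCD : (C : DPCore) → Coherent D C → ∀ k τ (τ∈Lₖ : T (L k τ)) →
                    ¬ DPCore.AcceptedBy C k τ → ¬ InPCD D C (Gₖ k τ τ∈Lₖ)
    rejected⇒∉PCD C coherent k τ τ∈Lₖ rejected (k′ , τ′ , τ′∈Lₖ′ , accepted , G≃G′) =
      rejected (Equivalence.from (proj₁ (coherent k k′ τ τ′ τ∈Lₖ τ′∈Lₖ′ G≃G′)) accepted)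

  module Reconstruction {r : ℕ} {D : DecompClass r} (𝒜 : Automation D) (C : DPCore)
                        (k m : ℕ) (R : Refutation 𝒜 C k m) where
    open DecompClass D
    open DPCore C
    open Refutation R
    open TreeAutomaton (Automation.A 𝒜 k)

    state : Fin m → Fin nStates
    state i = proj₁ (pairs i)

    witnesses : Fin m → List (Wit k)
    witnesses i = proj₂ (pairs i)

    record Realisation (i : Fin m) : Set where
      constructor realisation
      field
        term    : Term
        run     : Run term (state i)
        over    : Over (Σₖ k) term
        dyn     : Dyn k term ≡ witnesses i
        height≤ : height term ≤ toℕ i
        size≤   : size term ≤ geomSum r (suc (toℕ i))

    record Realisations (i : Fin m) {p : ℕ} (js : Vec (Fin m) p) : Set where
      constructor realisations
      field
        terms    : Vec Term p
        runs     : Runs terms (Vec.map state js)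
        overs    : OverV (Σₖ k) terms
        dyns     : Dyns k terms ≡ Vec.map witnesses js
        heights≤ : heights terms ≤ toℕ i
        sizes≤   : sizes terms ≤ p * geomSum r (toℕ i)

    -- The fuel n bounds the index and makes the recursion structural.
    mutual
      realise : ∀ n i → toℕ i < n → Realisation i
      realise (suc n) i (s≤s i≤n) with justified i
      ... | a , js , js<i , transition , Sᵢ≡â with realiseAll n i i≤n js js<i
      ... | realisations ts runs overs dyns heights≤ sizes≤ =
        realisation (node a ts) (node (Vec.map state js) transition runs) (node a∈Σₖ overs)
          (trans (cong (hatSet k a) dyns) (sym Sᵢ≡â)) heights≤
          (s≤s (≤-trans sizes≤ (*-monoˡ-≤ (geomSum r (toℕ i)) (Σ-arity k a a∈Σₖ))))
        where
        a∈Σₖ = All.lookup trans-alph transition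

      realiseAll : ∀ n i → toℕ i ≤ n → ∀ {p} (js : Vec (Fin m) p) →
                   All (λ j → toℕ j < toℕ i) (toList js) → Realisations i js
      realiseAll n i i≤n []       []          = realisations [] [] [] refl z≤n z≤n
      realiseAll n i i≤n (j ∷ js) (j<i ∷ js<i)
        with realise n j (≤-trans j<i i≤n) | realiseAll n i i≤n js js<i
      ... | realisation t run over dyn height≤ size≤
          | realisations ts runs overs dyns heights≤ sizes≤ =
        realisations (t ∷ ts) (run ∷ runs) (over ∷ overs) (cong₂ _∷_ dyn dyns)
          (⊔-lub (≤-trans (s≤s height≤) j<i) heights≤)
          (+-mono-≤ (≤-trans size≤ (geomSum-mono-≤ r j<i)) sizes≤)

    counterexample : Σ[ τ ∈ Term ] Σ[ τ∈Lₖ ∈ T (L k τ) ]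
                       ¬ AcceptedBy k τ × height τ ≤ m ∸ 1 × size τ ≤ geomSum r m
    counterexample with realise m lastIdx (subst (toℕ lastIdx <_) isLast ≤-refl)
    ... | realisation τ run over dyn height≤ size≤ =
      τ , τ∈Lₖ , rejected ,
      subst (height τ ≤_) (cong (_∸ 1) isLast) height≤ ,
      subst (λ n → size τ ≤ geomSum r n) isLast size≤
      where
      τ∈Lₖ = Equivalence.from (Automation.correct 𝒜 k τ) (over , state lastIdx , proj₁ lastInc , run)
      rejected : ¬ AcceptedBy k τ
      rejected accepted = proj₂ lastInc (subst (HasFinal k) dyn accepted)

corollary1 : (Sym : Set) (arity : Sym → ℕ) (r : ℕ)
    (D : Terms.DecompClass Sym arity r) (𝒜 : Terms.Automation Sym arity D)
    (C : Terms.DPCore Sym arity) → Terms.Coherent Sym arity D C →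
    (k m : ℕ) → Terms.Refutation Sym arity 𝒜 C k m →
    Σ[ τ ∈ Terms.Term Sym arity ] Σ[ p ∈ T (Terms.DecompClass.L D k τ) ]
        Terms.DecompClass.InPDk D k (Terms.DecompClass.Gₖ D k τ p)
      × ¬ Terms.InPCD Sym arity D C (Terms.DecompClass.Gₖ D k τ p)
      × Terms.height Sym arity τ ≤ m ∸ 1
      × (r ≡ 1 → Terms.size Sym arity τ ≤ m)
      × ((h : 1 < r) → Terms.size Sym arity τ ≤ geomBound r m h)
corollary1 Sym arity r D 𝒜 C coherent k m R
  with Reconstruction.counterexample Sym arity 𝒜 C k m R
... | τ , τ∈Lₖ , rejected , height≤ , size≤ =
  τ , τ∈Lₖ ,
  Gₖ∈PDk Sym arity D k τ τ∈Lₖ ,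
  rejected⇒∉PCD Sym arity D C coherent k τ τ∈Lₖ rejected ,
  height≤ ,
  (λ { refl → ≤-trans size≤ (≤-reflexive (geomSum-1 m)) }) ,
  (λ 1<r → ≤-trans size≤ (≤-reflexive (geomSum≡geomBound r m 1<r)))
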